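{- Let $\Gamma$ be an $\omega$-clique regular graph ($\omega\ge 2$) with maximum degree $\Delta(\Gamma)$. Then every eigenvalue $\lambda$ of the adjacency matrix of $C_\omega(\Gamma)$ satisfies \[-\omega\le\lambda\le\omega\left(\frac{\Delta(\Gamma)}{\omega-1}-1\right).\]
   Context: All graphs are finite, without loops or parallel edges. A graph is $\omega$-clique regular if its edge set is nonempty and every edge lies in exactly one clique of order $\omega$ (set of $\omega$ pairwise adjacent vertices). The $\omega$-clique graph $C_\omega(\Gamma)$ has the cliques of order $\omega$ of $\Gamma$ as vertices, two distinct cliques being adjacent iff they have nonempty intersection. -}

module Defs where

open import Level using (Level; _⊔_) renaming (suc to lsuc)
open import Data.Bool using (Bool; true; false)
open import Data.Bool.Properties using () renaming (_≟_ to _≟ᵇ_)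
open import Data.Nat using (ℕ; zero; suc) renaming (_⊔_ to _⊔ℕ_)
open import Data.Fin using (Fin)
open import Data.Fin.Subset using (Subset; _∈_; _∩_; ∣_∣; Nonempty)
open import Data.Fin.Subset.Properties using (nonempty?)
open import Data.Vec using (tabulate)
open import Data.Vec.Properties using (≡-dec)
open import Data.List using (List; length; lookup; foldr; map; allFin)
open import Data.List.Membership.Propositional using () renaming (_∈_ to _∈ˡ_)
open import Data.List.Relation.Unary.Unique.Propositional using (Unique)
open import Data.Product using (Σ; ∃; ∃-syntax; _×_; _,_)
open import Relation.Nullary using (¬_; yes; no)
open import Relation.Binary.PropositionalEquality using (_≡_; _≢_)
open import Relation.Binary.Structures using (IsTotalOrder)
open import Algebra.Structures using (IsCommutativeRing)
open import Function.Bundles using (_⇔_)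

-- Ordered fields (the stdlib has no reals; eigenvalues are taken in an
-- arbitrary ordered field, ℝ being one instance).

record OrderedField (c ℓ₁ ℓ₂ : Level) : Set (lsuc (c ⊔ ℓ₁ ⊔ ℓ₂)) where
  infix  4 _≈_ _≤_
  infixl 7 _*_
  infixl 6 _+_
  field
    Carrier           : Set c
    _≈_               : Carrier → Carrier → Set ℓ₁
    _≤_               : Carrier → Carrier → Set ℓ₂
    _+_               : Carrier → Carrier → Carrier
    _*_               : Carrier → Carrier → Carrier
    -_                : Carrier → Carrier
    0#                : Carrier
    1#                : Carrier
    isCommutativeRing : IsCommutativeRing _≈_ _+_ _*_ -_ 0# 1#
    isTotalOrder      : IsTotalOrder _≈_ _≤_
    0≉1               : ¬ (0# ≈ 1#)
    inverse           : ∀ x → ¬ (x ≈ 0#) → ∃[ y ] (x * y ≈ 1#)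
    +-monoˡ-≤         : ∀ {x y} z → x ≤ y → x + z ≤ y + z
    *-nonneg          : ∀ {x y} → 0# ≤ x → 0# ≤ y → 0# ≤ x * y

  infixl 6 _-_
  _-_ : Carrier → Carrier → Carrier
  x - y = x + (- y)

  fromℕ : ℕ → Carrier
  fromℕ zero    = 0#
  fromℕ (suc n) = 1# + fromℕ n

  ∑ : ∀ {m} → (Fin m → Carrier) → Carrier
  ∑ {zero}  f = 0#
  ∑ {suc m} f = f Fin.zero + ∑ (λ i → f (Fin.suc i))

record Graph (n : ℕ) : Set where
  field
    adj   : Fin n → Fin n → Bool
    sym   : ∀ i j → adj i j ≡ adj j i
    irrefl : ∀ i → adj i i ≡ false

module _ {n : ℕ} (Γ : Graph n) where
  open Graph Γ

  Adjacent : Fin n → Fin n → Set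
  Adjacent i j = adj i j ≡ true

  IsClique : ℕ → Subset n → Set
  IsClique ω K = ∣ K ∣ ≡ ω × (∀ i j → i ∈ K → j ∈ K → i ≢ j → Adjacent i j)

  CliqueRegular : ℕ → Set
  CliqueRegular ω =
    (∃[ i ] ∃[ j ] Adjacent i j) ×
    (∀ i j → Adjacent i j →
       ∃[ K ] (IsClique ω K × i ∈ K × j ∈ K ×
               (∀ K′ → IsClique ω K′ → i ∈ K′ → j ∈ K′ → K′ ≡ K)))

  degree : Fin n → ℕ
  degree i = ∣ tabulate (adj i) ∣

  maxDegree : ℕ
  maxDegree = foldr _⊔ℕ_ 0 (map degree (allFin n))

  -- Ks lists every ω-clique of Γ exactly once (an ordering of the vertex
  -- set of C_ω(Γ))
  EnumeratesCliques : ℕ → List (Subset n) → Set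
  EnumeratesCliques ω Ks = Unique Ks × (∀ K → (K ∈ˡ Ks) ⇔ IsClique ω K)

module _ {c ℓ₁ ℓ₂} (F : OrderedField c ℓ₁ ℓ₂) where
  open OrderedField F

  cliqueAdj : ∀ {n} → Subset n → Subset n → Carrier
  cliqueAdj K K′ with ≡-dec _≟ᵇ_ K K′
  ... | yes _ = 0#
  ... | no  _ with nonempty? (K ∩ K′)
  ...   | yes _ = 1#
  ...   | no  _ = 0#

  cliqueGraphMatrix : ∀ {n} (Ks : List (Subset n)) →
                      Fin (length Ks) → Fin (length Ks) → Carrier
  cliqueGraphMatrix Ks a b = cliqueAdj (lookup Ks a) (lookup Ks b)

  IsEigenvalue : ∀ {m} → (Fin m → Fin m → Carrier) → Carrier → Set (c ⊔ ℓ₁)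
  IsEigenvalue {m} A λ′ =
    Σ (Fin m → Carrier) λ v → ((∃[ a ] ¬ (v a ≈ 0#)) ×
            (∀ a → ∑ (λ b → A a b * v b) ≈ λ′ * v a))

{-# OPTIONS --safe #-}
-- Let N be the vertex–clique incidence matrix of Γ. Two distinct ω-cliques share at most one
-- vertex, since a shared edge would lie in both, so NᵀN = A + ωI for the adjacency matrix A of
-- C_ω(Γ). As a Gram matrix, A + ωI has no negative eigenvalue, whence λ ≥ -ω. The row of A + ωI
-- at a clique K sums to Σ_{x ∈ K} c(x), where c(x) counts the cliques through x; these meet
-- pairwise only in x, so (ω - 1) c(x) ≤ deg x ≤ Δ. An eigenvalue of a nonnegative matrix is at
-- most its largest row sum, so (ω - 1)(λ + ω) ≤ ωΔ.
module Submission where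

open import Defs
open import Level using (Level)
open import Data.Nat using (ℕ; _∸_) renaming (_≤_ to _≤ℕ_; _*_ to _*ℕ_)
open import Data.Fin.Subset using (Subset)
open import Data.List using (List)
open import Data.Product using (_×_)

open import Algebra.Bundles using (CommutativeRing)
import Algebra.Properties.Semiring.Sum
open import Data.Bool using (Bool; true; false; _∧_)
open import Data.Bool.Properties using () renaming (_≟_ to _≟ᵇ_)
open import Data.Fin using (Fin; zero; suc; punchIn; _≟_)
open import Data.Fin.Properties using (punchInᵢ≢i; suc-injective)
open import Data.Fin.Subset using (_∈_; _∉_; _∩_; ∣_∣; ⁅_⁆; Nonempty; Empty; inside; outside)
open import Data.Fin.Subset.Properties
  using (nonempty?; _∈?_; Empty-unique; ∣⊥∣≡0; ∣⁅x⁆∣≡1; x∈⁅x⁆; x∈⁅y⁆⇒x≡y; p⊆q⇒∣p∣≤∣q∣;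
         x∈p∩q⁻; ∩-idem; p─⊥≡p; p─q⊆p)
import Data.List as List
open import Data.List.Membership.Propositional.Properties using (∈-lookup; ∈-allFin)
open import Data.List.Properties using (foldr-forcesᵇ)
open import Data.List.Relation.Unary.All as All using (All)
open import Data.List.Relation.Unary.All.Properties using (map⁻)
open import Data.List.Relation.Unary.AllPairs using (_∷_)
open import Data.List.Relation.Unary.Unique.Propositional using (Unique)
import Data.Nat as ℕ
import Data.Nat.Properties as ℕₚ
open import Data.Product using (_,_; proj₁; proj₂)
open import Data.Sum using (inj₁; inj₂)
open import Data.Vec as Vec using (tabulate; here; there)
open import Data.Vec.Functional using (Vector; removeAt)
open import Data.Vec.Properties using (≡-dec; lookup∘tabulate; lookup-zipWith; lookup⇒[]=; []=⇒lookup)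
open import Function using (_∘_; flip; case_of_; Equivalence)
open import Relation.Binary.Bundles using (TotalOrder)
open import Relation.Binary.PropositionalEquality as ≡ using (_≡_; _≢_)
open import Relation.Nullary using (¬_; yes; no; contradiction)
open import Relation.Nullary.Decidable using (decidable-stable)

module ℕΣ = Algebra.Properties.Semiring.Sum ℕₚ.+-*-semiring

lookup-injective : ∀ {A : Set} {xs : List A} → Unique xs →
                   ∀ {i j} → List.lookup xs i ≡ List.lookup xs j → i ≡ j
lookup-injective (_    ∷ _)      {zero}  {zero}  _  = ≡.refl
lookup-injective (x≢xs ∷ _)      {zero}  {suc j} eq = contradiction eq (All.lookup x≢xs (∈-lookup j))
lookup-injective (x≢xs ∷ _)      {suc i} {zero}  eq = contradiction (≡.sym eq) (All.lookup x≢xs (∈-lookup i))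
lookup-injective (_    ∷ unique) {suc i} {suc j} eq = ≡.cong suc (lookup-injective unique eq)

module Counting where
  open ≡ using (refl; sym; trans; cong; cong₂; subst)
  open import Data.Fin.Subset using (_-_)
  open ℕΣ using (sum; sum-cong-≋)

  [_] : Bool → ℕ
  [ true  ] = 1
  [ false ] = 0

  [∧]≡[]*[] : ∀ b c → [ b ∧ c ] ≡ [ b ] ℕ.* [ c ]
  [∧]≡[]*[] true  c = sym (ℕₚ.+-identityʳ [ c ])
  [∧]≡[]*[] false c = refl

  𝟙 : ∀ {n} → Subset n → Fin n → ℕ
  𝟙 p x = [ Vec.lookup p x ]

  ∣p∣≡∑𝟙 : ∀ {n} (p : Subset n) → ∣ p ∣ ≡ sum (𝟙 p)
  ∣p∣≡∑𝟙 Vec.[]            = refl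
  ∣p∣≡∑𝟙 (inside  Vec.∷ p) = cong ℕ.suc (∣p∣≡∑𝟙 p)
  ∣p∣≡∑𝟙 (outside Vec.∷ p) = ∣p∣≡∑𝟙 p

  𝟙-∩ : ∀ {n} (p q : Subset n) x → 𝟙 (p ∩ q) x ≡ 𝟙 p x ℕ.* 𝟙 q x
  𝟙-∩ p q x = trans (cong [_] (lookup-zipWith _∧_ x p q)) ([∧]≡[]*[] (Vec.lookup p x) (Vec.lookup q x))

  ∣p∩q∣≡∑𝟙*𝟙 : ∀ {n} (p q : Subset n) → ∣ p ∩ q ∣ ≡ sum (λ x → 𝟙 p x ℕ.* 𝟙 q x)
  ∣p∩q∣≡∑𝟙*𝟙 p q = trans (∣p∣≡∑𝟙 (p ∩ q)) (sum-cong-≋ (𝟙-∩ p q))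

  𝟙-∈ : ∀ {n} {p : Subset n} {x} → x ∈ p → 𝟙 p x ≡ 1
  𝟙-∈ x∈p = cong [_] ([]=⇒lookup x∈p)

  𝟙-∉ : ∀ {n} {p : Subset n} {x} → x ∉ p → 𝟙 p x ≡ 0
  𝟙-∉ {p = p} {x} x∉p with Vec.lookup p x in eq
  ... | inside  = contradiction (lookup⇒[]= x p eq) x∉p
  ... | outside = refl

  Empty⇒∣p∣≡0 : ∀ {n} {p : Subset n} → Empty p → ∣ p ∣ ≡ 0
  Empty⇒∣p∣≡0 {n} empty = trans (cong ∣_∣ (Empty-unique empty)) (∣⊥∣≡0 n)

  Nonempty⇒1≤∣p∣ : ∀ {n} {p : Subset n} → Nonempty p → 1 ≤ℕ ∣ p ∣
  Nonempty⇒1≤∣p∣ {p = p} (x , x∈p) =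
    subst (_≤ℕ ∣ p ∣) (∣⁅x⁆∣≡1 x) (p⊆q⇒∣p∣≤∣q∣ (λ y∈⁅x⁆ → subst (_∈ p) (sym (x∈⁅y⁆⇒x≡y x y∈⁅x⁆)) x∈p))

  ∣p∣≤1 : ∀ {n} {p : Subset n} → (∀ {x y} → x ∈ p → y ∈ p → x ≡ y) → ∣ p ∣ ≤ℕ 1
  ∣p∣≤1 {p = p} unique with nonempty? p
  ... | yes (x , x∈p) =
    subst (∣ p ∣ ≤ℕ_) (∣⁅x⁆∣≡1 x) (p⊆q⇒∣p∣≤∣q∣ (λ y∈p → subst (_∈ ⁅ x ⁆) (unique x∈p y∈p) (x∈⁅x⁆ x)))
  ... | no empty = subst (_≤ℕ 1) (sym (Empty⇒∣p∣≡0 empty)) ℕ.z≤n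

  x∈p-y⇒x≢y : ∀ {n} {p : Subset n} {x y} → x ∈ p - y → x ≢ y
  x∈p-y⇒x≢y {p = _ Vec.∷ _} {zero} {zero} ()
  x∈p-y⇒x≢y {x = zero}  {suc y} _ ()
  x∈p-y⇒x≢y {x = suc x} {zero}  _ ()
  x∈p-y⇒x≢y {p = _ Vec.∷ _} {suc x} {suc y} (there x∈p-y) = x∈p-y⇒x≢y x∈p-y ∘ suc-injective

  ∣p∣≡1+∣p-x∣ : ∀ {n} {p : Subset n} {x} → x ∈ p → ∣ p ∣ ≡ ℕ.suc ∣ p - x ∣
  ∣p∣≡1+∣p-x∣ {p = inside  Vec.∷ p} here        = cong (ℕ.suc ∘ ∣_∣) (sym (p─⊥≡p p))
  ∣p∣≡1+∣p-x∣ {p = inside  Vec.∷ p} (there x∈p) = cong ℕ.suc (∣p∣≡1+∣p-x∣ x∈p)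
  ∣p∣≡1+∣p-x∣ {p = outside Vec.∷ p} (there x∈p) = ∣p∣≡1+∣p-x∣ x∈p

  sum-mono-≤ : ∀ {k} {f g : Fin k → ℕ} → (∀ i → f i ≤ℕ g i) → sum f ≤ℕ sum g
  sum-mono-≤ {ℕ.zero}  f≤g = ℕ.z≤n
  sum-mono-≤ {ℕ.suc k} f≤g = ℕₚ.+-mono-≤ (f≤g zero) (sum-mono-≤ (f≤g ∘ suc))

  blocksThrough : ∀ {n m} → (Fin m → Subset n) → Fin n → Subset m
  blocksThrough K x = tabulate (λ a → Vec.lookup (K a) x)

  𝟙-blocksThrough : ∀ {n m} (K : Fin m → Subset n) x a → 𝟙 (blocksThrough K x) a ≡ 𝟙 (K a) x
  𝟙-blocksThrough K x a = cong [_] (lookup∘tabulate _ a)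

  ∈-blocksThrough⁻ : ∀ {n m} (K : Fin m → Subset n) {x a} → a ∈ blocksThrough K x → x ∈ K a
  ∈-blocksThrough⁻ K {x} {a} a∈ =
    lookup⇒[]= x (K a) (trans (sym (lookup∘tabulate _ a)) ([]=⇒lookup a∈))

  ∣blocksThrough∣≡∑ : ∀ {n m} (K : Fin m → Subset n) x → ∣ blocksThrough K x ∣ ≡ sum (λ a → 𝟙 (K a) x)
  ∣blocksThrough∣≡∑ K x = trans (∣p∣≡∑𝟙 (blocksThrough K x)) (sum-cong-≋ (𝟙-blocksThrough K x))

  ∣blocksThrough∩blocksThrough∣≡∑ : ∀ {n m} (K L : Fin m → Subset n) x y →
    ∣ blocksThrough K x ∩ blocksThrough L y ∣ ≡ sum (λ a → 𝟙 (K a) x ℕ.* 𝟙 (L a) y)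
  ∣blocksThrough∩blocksThrough∣≡∑ K L x y =
    trans (∣p∩q∣≡∑𝟙*𝟙 (blocksThrough K x) (blocksThrough L y))
          (sum-cong-≋ (λ a → cong₂ ℕ._*_ (𝟙-blocksThrough K x a) (𝟙-blocksThrough L y a)))

  degree≡∑ : ∀ {n} (Γ : Graph n) x → degree Γ x ≡ sum (λ y → [ Graph.adj Γ x y ])
  degree≡∑ Γ x = trans (∣p∣≡∑𝟙 (tabulate (Graph.adj Γ x))) (sum-cong-≋ (λ y → cong [_] (lookup∘tabulate (Graph.adj Γ x) y)))

  degree≤maxDegree : ∀ {n} (Γ : Graph n) x → degree Γ x ≤ℕ maxDegree Γ
  degree≤maxDegree {n} Γ x = All.lookup (map⁻ degrees≤max) (∈-allFin x)
    where
    degrees≤max : All (_≤ℕ maxDegree Γ) (List.map (degree Γ) (List.allFin n))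
    degrees≤max = foldr-forcesᵇ (λ j k j⊔k≤ → ℕₚ.m⊔n≤o⇒m≤o j k j⊔k≤ , ℕₚ.m⊔n≤o⇒n≤o j k j⊔k≤)
                                0 (List.map (degree Γ) (List.allFin n)) ℕₚ.≤-refl

module EdgeDisjointCliques {n} (Γ : Graph n) (ω : ℕ) {m} (K : Fin m → Subset n)
  (K-clique : ∀ a → IsClique Γ ω (K a))
  (edge-unique : ∀ {a b x y} → x ≢ y → x ∈ K a → y ∈ K a → x ∈ K b → y ∈ K b → a ≡ b) where
  open Counting
  open ≡ using (sym; trans; cong)
  open import Data.Fin.Subset using (_-_)
  open ℕΣ using (sum; ∑-comm; *-distribˡ-sum; *-distribʳ-sum; sum-cong-≋)
  open import Algebra.Properties.CommutativeSemigroup ℕₚ.*-commutativeSemigroup using (x∙yz≈y∙xz)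
  open Graph Γ using (adj)

  ∣K∩K∣≡ω : ∀ a → ∣ K a ∩ K a ∣ ≡ ω
  ∣K∩K∣≡ω a = trans (cong ∣_∣ (∩-idem (K a))) (proj₁ (K-clique a))

  ∣K∩K∣≤1 : ∀ {a b} → a ≢ b → ∣ K a ∩ K b ∣ ≤ℕ 1
  ∣K∩K∣≤1 {a} {b} a≢b = ∣p∣≤1 λ {x} {y} x∈ y∈ → decidable-stable (x ≟ y) λ x≢y →
    let x∈a , x∈b = x∈p∩q⁻ (K a) (K b) x∈
        y∈a , y∈b = x∈p∩q⁻ (K a) (K b) y∈
    in a≢b (edge-unique x≢y x∈a y∈a x∈b y∈b)

  cliqueCount : Fin n → ℕ
  cliqueCount x = ∣ blocksThrough K x ∣

  private
    ∸1*𝟙≡∣K-x∣*𝟙 : ∀ a x → (ω ∸ 1) ℕ.* 𝟙 (K a) x ≡ ∣ K a - x ∣ ℕ.* 𝟙 (K a) x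
    ∸1*𝟙≡∣K-x∣*𝟙 a x with x ∈? K a
    ... | yes x∈K rewrite 𝟙-∈ x∈K =
      cong (ℕ._* 1) (cong (_∸ 1) (trans (sym (proj₁ (K-clique a))) (∣p∣≡1+∣p-x∣ x∈K)))
    ... | no  x∉K rewrite 𝟙-∉ x∉K = trans (ℕₚ.*-zeroʳ (ω ∸ 1)) (sym (ℕₚ.*-zeroʳ ∣ K a - x ∣))

    cliquesOnEdge : Fin n → Fin n → Subset m
    cliquesOnEdge x y = blocksThrough (λ a → K a - x) y ∩ blocksThrough K x

    ∈-cliquesOnEdge⁻ : ∀ {x y a} → a ∈ cliquesOnEdge x y → y ∈ K a × x ∈ K a × x ≢ y
    ∈-cliquesOnEdge⁻ {x} {y} {a} a∈ =
      let y∈a-x , x∈a = x∈p∩q⁻ (blocksThrough (λ b → K b - x) y) (blocksThrough K x) a∈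
          y∈a-x = ∈-blocksThrough⁻ (λ b → K b - x) y∈a-x
      in p─q⊆p (K a) ⁅ x ⁆ y∈a-x , ∈-blocksThrough⁻ K x∈a , x∈p-y⇒x≢y y∈a-x ∘ sym

    ∣cliquesOnEdge∣≤adj : ∀ x y → ∣ cliquesOnEdge x y ∣ ≤ℕ [ adj x y ]
    ∣cliquesOnEdge∣≤adj x y with adj x y in x~y
    ... | true  = ∣p∣≤1 {p = cliquesOnEdge x y} λ a∈ b∈ →
      let y∈a , x∈a , x≢y = ∈-cliquesOnEdge⁻ a∈
          y∈b , x∈b , _   = ∈-cliquesOnEdge⁻ b∈
      in edge-unique x≢y x∈a y∈a x∈b y∈b
    ... | false = ℕₚ.≤-reflexive (Empty⇒∣p∣≡0 {p = cliquesOnEdge x y} λ (a , a∈) →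
      let y∈a , x∈a , x≢y = ∈-cliquesOnEdge⁻ a∈
      in case trans (sym x~y) (proj₂ (K-clique a) x y x∈a y∈a x≢y) of λ ())

  open ℕₚ.≤-Reasoning

  -- The sets K a - x, for the cliques K a through x, are pairwise disjoint sets of neighbours of x.
  ∸1*cliqueCount≤degree : ∀ x → (ω ∸ 1) ℕ.* cliqueCount x ≤ℕ degree Γ x
  ∸1*cliqueCount≤degree x = begin
    (ω ∸ 1) ℕ.* cliqueCount x                                ≡⟨ cong ((ω ∸ 1) ℕ.*_) (∣blocksThrough∣≡∑ K x) ⟩
    (ω ∸ 1) ℕ.* sum (λ a → 𝟙 (K a) x)                        ≡⟨ *-distribˡ-sum (ω ∸ 1) (λ a → 𝟙 (K a) x) ⟩
    sum (λ a → (ω ∸ 1) ℕ.* 𝟙 (K a) x)                        ≡⟨ sum-cong-≋ (λ a → ∸1*𝟙≡∣K-x∣*𝟙 a x) ⟩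
    sum (λ a → ∣ K a - x ∣ ℕ.* 𝟙 (K a) x)                    ≡⟨ sum-cong-≋ (λ a → trans (cong (ℕ._* 𝟙 (K a) x) (∣p∣≡∑𝟙 (K a - x)))
                                                                                          (*-distribʳ-sum (𝟙 (K a) x) (𝟙 (K a - x)))) ⟩
    sum (λ a → sum (λ y → 𝟙 (K a - x) y ℕ.* 𝟙 (K a) x))      ≡⟨ ∑-comm (λ a y → 𝟙 (K a - x) y ℕ.* 𝟙 (K a) x) ⟩
    sum (λ y → sum (λ a → 𝟙 (K a - x) y ℕ.* 𝟙 (K a) x))      ≡⟨ sum-cong-≋ (λ y → ∣blocksThrough∩blocksThrough∣≡∑ (λ a → K a - x) K y x) ⟨
    sum (λ y → ∣ cliquesOnEdge x y ∣)                        ≤⟨ sum-mono-≤ (∣cliquesOnEdge∣≤adj x) ⟩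
    sum (λ y → [ adj x y ])                                  ≡⟨ degree≡∑ Γ x ⟨
    degree Γ x                                               ∎

  ∑∣K∩K∣≡∑𝟙*cliqueCount : ∀ a → sum (λ b → ∣ K a ∩ K b ∣) ≡ sum (λ x → 𝟙 (K a) x ℕ.* cliqueCount x)
  ∑∣K∩K∣≡∑𝟙*cliqueCount a = begin-equality
    sum (λ b → ∣ K a ∩ K b ∣)                          ≡⟨ sum-cong-≋ (λ b → ∣p∩q∣≡∑𝟙*𝟙 (K a) (K b)) ⟩
    sum (λ b → sum (λ x → 𝟙 (K a) x ℕ.* 𝟙 (K b) x))    ≡⟨ ∑-comm (λ b x → 𝟙 (K a) x ℕ.* 𝟙 (K b) x) ⟩
    sum (λ x → sum (λ b → 𝟙 (K a) x ℕ.* 𝟙 (K b) x))    ≡⟨ sum-cong-≋ (λ x → *-distribˡ-sum (𝟙 (K a) x) (λ b → 𝟙 (K b) x)) ⟨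
    sum (λ x → 𝟙 (K a) x ℕ.* sum (λ b → 𝟙 (K b) x))    ≡⟨ sum-cong-≋ (λ x → cong (𝟙 (K a) x ℕ.*_) (∣blocksThrough∣≡∑ K x)) ⟨
    sum (λ x → 𝟙 (K a) x ℕ.* cliqueCount x)            ∎

  ∸1*∑∣K∩K∣≤ω*maxDegree : ∀ a → (ω ∸ 1) ℕ.* sum (λ b → ∣ K a ∩ K b ∣) ≤ℕ ω ℕ.* maxDegree Γ
  ∸1*∑∣K∩K∣≤ω*maxDegree a = begin
    (ω ∸ 1) ℕ.* sum (λ b → ∣ K a ∩ K b ∣)              ≡⟨ cong ((ω ∸ 1) ℕ.*_) (∑∣K∩K∣≡∑𝟙*cliqueCount a) ⟩
    (ω ∸ 1) ℕ.* sum (λ x → 𝟙 (K a) x ℕ.* cliqueCount x) ≡⟨ *-distribˡ-sum (ω ∸ 1) (λ x → 𝟙 (K a) x ℕ.* cliqueCount x) ⟩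
    sum (λ x → (ω ∸ 1) ℕ.* (𝟙 (K a) x ℕ.* cliqueCount x)) ≡⟨ sum-cong-≋ (λ x → x∙yz≈y∙xz (ω ∸ 1) (𝟙 (K a) x) (cliqueCount x)) ⟩
    sum (λ x → 𝟙 (K a) x ℕ.* ((ω ∸ 1) ℕ.* cliqueCount x)) ≤⟨ sum-mono-≤ (λ x → ℕₚ.*-monoʳ-≤ (𝟙 (K a) x)
                                                              (ℕₚ.≤-trans (∸1*cliqueCount≤degree x) (degree≤maxDegree Γ x))) ⟩
    sum (λ x → 𝟙 (K a) x ℕ.* maxDegree Γ)             ≡⟨ *-distribʳ-sum (maxDegree Γ) (𝟙 (K a)) ⟨
    sum (𝟙 (K a)) ℕ.* maxDegree Γ                     ≡⟨ cong (ℕ._* maxDegree Γ) (trans (sym (∣p∣≡∑𝟙 (K a))) (proj₁ (K-clique a))) ⟩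
    ω ℕ.* maxDegree Γ                                 ∎

module OrderedFieldProperties {c ℓ₁ ℓ₂} (F : OrderedField c ℓ₁ ℓ₂) where
  open OrderedField F

  commutativeRing : CommutativeRing c ℓ₁
  commutativeRing = record { isCommutativeRing = isCommutativeRing }

  totalOrder : TotalOrder c ℓ₁ ℓ₂
  totalOrder = record { isTotalOrder = isTotalOrder }

  open CommutativeRing commutativeRing public
    using (refl; sym; trans; +-cong; +-congˡ; +-congʳ; *-congˡ; *-congʳ; +-comm; *-comm;
           +-assoc; *-assoc; distribˡ; distribʳ; -‿cong; -‿inverseʳ; -‿inverseˡ;
           +-identityˡ; +-identityʳ; *-identityˡ; zeroˡ; zeroʳ; ring; semiring)
    renaming (reflexive to ≈-reflexive)
  open import Algebra.Properties.Ring ring public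
    using (-‿involutive; -0#≈0#; -1*x≈-x; -‿distribˡ-*; -‿distribʳ-*; x[y-z]≈xy-xz; x∙y⁻¹≈ε⇒x≈y; x≈y⇒x∙y⁻¹≈ε)
  open TotalOrder totalOrder public
    using (poset; total; antisym) renaming (refl to ≤-refl; trans to ≤-trans; reflexive to ≤-reflexive)
  open import Relation.Binary.Reasoning.PartialOrder poset public

  +-monoʳ-≤ : ∀ {x y} z → x ≤ y → z + x ≤ z + y
  +-monoʳ-≤ {x} {y} z x≤y = begin
    z + x ≈⟨ +-comm z x ⟩ x + z ≤⟨ +-monoˡ-≤ z x≤y ⟩ y + z ≈⟨ +-comm y z ⟩ z + y ∎

  +-mono-≤ : ∀ {x y u w} → x ≤ y → u ≤ w → x + u ≤ y + w
  +-mono-≤ {y = y} {u} x≤y u≤w = ≤-trans (+-monoˡ-≤ u x≤y) (+-monoʳ-≤ y u≤w)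

  x+z-z≈x : ∀ x z → x + z - z ≈ x
  x+z-z≈x x z = trans (+-assoc x z (- z)) (trans (+-congˡ (-‿inverseʳ z)) (+-identityʳ x))

  x+z≤y⇒x≤y-z : ∀ {x y z} → x + z ≤ y → x ≤ y - z
  x+z≤y⇒x≤y-z {x} {y} {z} x+z≤y = begin
    x         ≈⟨ x+z-z≈x x z ⟨
    x + z - z ≤⟨ +-monoˡ-≤ (- z) x+z≤y ⟩
    y - z     ∎

  +-cancelʳ-≤ : ∀ {x y} z → x + z ≤ y + z → x ≤ y
  +-cancelʳ-≤ {x} {y} z x+z≤y+z = ≤-trans (x+z≤y⇒x≤y-z x+z≤y+z) (≤-reflexive (x+z-z≈x y z))

  x≤0⇒0≤-x : ∀ {x} → x ≤ 0# → 0# ≤ - x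
  x≤0⇒0≤-x {x} x≤0 = +-cancelʳ-≤ x (begin
    0# + x  ≈⟨ +-identityˡ x ⟩
    x       ≤⟨ x≤0 ⟩
    0#      ≈⟨ -‿inverseˡ x ⟨
    - x + x ∎)

  0≤x⇒-x≤0 : ∀ {x} → 0# ≤ x → - x ≤ 0#
  0≤x⇒-x≤0 {x} 0≤x = +-cancelʳ-≤ x (begin
    - x + x ≈⟨ -‿inverseˡ x ⟩
    0#      ≤⟨ 0≤x ⟩
    x       ≈⟨ +-identityˡ x ⟨
    0# + x  ∎)

  *-monoˡ-≤ : ∀ {z x y} → 0# ≤ z → x ≤ y → z * x ≤ z * y
  *-monoˡ-≤ {z} {x} {y} 0≤z x≤y = +-cancelʳ-≤ (- (z * x)) (begin
    z * x - z * x  ≈⟨ -‿inverseʳ (z * x) ⟩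
    0#             ≤⟨ *-nonneg 0≤z (≤-trans (≤-reflexive (sym (-‿inverseʳ x))) (+-monoˡ-≤ (- x) x≤y)) ⟩
    z * (y - x)    ≈⟨ x[y-z]≈xy-xz z y x ⟩
    z * y - z * x  ∎)

  *-monoʳ-≤ : ∀ {z x y} → 0# ≤ z → x ≤ y → x * z ≤ y * z
  *-monoʳ-≤ {z} {x} {y} 0≤z x≤y = begin
    x * z ≈⟨ *-comm x z ⟩ z * x ≤⟨ *-monoˡ-≤ 0≤z x≤y ⟩ z * y ≈⟨ *-comm z y ⟩ y * z ∎

  x*x-nonneg : ∀ x → 0# ≤ x * x
  x*x-nonneg x with total 0# x
  ... | inj₁ 0≤x = *-nonneg 0≤x 0≤x
  ... | inj₂ x≤0 = begin
    0#        ≤⟨ *-nonneg (x≤0⇒0≤-x x≤0) (x≤0⇒0≤-x x≤0) ⟩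
    - x * - x ≈⟨ -‿distribˡ-* x (- x) ⟨
    - (x * - x) ≈⟨ -‿cong (-‿distribʳ-* x x) ⟨
    - - (x * x) ≈⟨ -‿involutive (x * x) ⟩
    x * x     ∎

  0≤1 : 0# ≤ 1#
  0≤1 = ≤-trans (x*x-nonneg 1#) (≤-reflexive (*-identityˡ 1#))

  x≉0∧xy≈0⇒y≈0 : ∀ {x y} → ¬ (x ≈ 0#) → x * y ≈ 0# → y ≈ 0#
  x≉0∧xy≈0⇒y≈0 {x} {y} x≉0 xy≈0 with inverse x x≉0
  ... | x⁻¹ , xx⁻¹≈1 = begin-equality
    y               ≈⟨ *-identityˡ y ⟨
    1# * y          ≈⟨ *-congʳ (trans (sym xx⁻¹≈1) (*-comm x x⁻¹)) ⟩
    x⁻¹ * x * y     ≈⟨ *-assoc x⁻¹ x y ⟩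
    x⁻¹ * (x * y)   ≈⟨ *-congˡ xy≈0 ⟩
    x⁻¹ * 0#        ≈⟨ zeroʳ x⁻¹ ⟩
    0#              ∎

  *-cancelʳ-≤ : ∀ {z x y} → 0# ≤ z → ¬ (z ≈ 0#) → x * z ≤ y * z → x ≤ y
  *-cancelʳ-≤ {z} {x} {y} 0≤z z≉0 xz≤yz with total x y
  ... | inj₁ x≤y = x≤y
  ... | inj₂ y≤x = ≤-reflexive (x∙y⁻¹≈ε⇒x≈y x y (x≉0∧xy≈0⇒y≈0 z≉0 (begin-equality
    z * (x - y)    ≈⟨ x[y-z]≈xy-xz z x y ⟩
    z * x - z * y  ≈⟨ +-cong (*-comm z x) (-‿cong (*-comm z y)) ⟩
    x * z - y * z  ≈⟨ x≈y⇒x∙y⁻¹≈ε (antisym xz≤yz (*-monoʳ-≤ 0≤z y≤x)) ⟩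
    0#             ∎)))

  open import Algebra.Properties.Semiring.Sum semiring public
    using (sum; sum-cong-≋; sum-remove; sum-replicate-zero; ∑-comm; *-distribˡ-sum; *-distribʳ-sum)

  ∑≡sum : ∀ {k} (f : Vector Carrier k) → ∑ f ≡ sum f
  ∑≡sum {ℕ.zero}  f = ≡.refl
  ∑≡sum {ℕ.suc k} f = ≡.cong (f zero +_) (∑≡sum (f ∘ suc))

  sum-mono-≤ : ∀ {k} {f g : Vector Carrier k} → (∀ i → f i ≤ g i) → sum f ≤ sum g
  sum-mono-≤ {ℕ.zero}  f≤g = ≤-refl
  sum-mono-≤ {ℕ.suc k} f≤g = +-mono-≤ (f≤g zero) (sum-mono-≤ (f≤g ∘ suc))

  sum-nonneg : ∀ {k} {f : Vector Carrier k} → (∀ i → 0# ≤ f i) → 0# ≤ sum f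
  sum-nonneg {k} 0≤f = ≤-trans (≤-reflexive (sym (sum-replicate-zero k))) (sum-mono-≤ 0≤f)

  ≤-sum : ∀ {k} {f : Vector Carrier k} → (∀ i → 0# ≤ f i) → ∀ i → f i ≤ sum f
  ≤-sum {ℕ.suc k} {f} 0≤f i = begin
    f i                      ≈⟨ +-identityʳ (f i) ⟨
    f i + 0#                 ≤⟨ +-monoʳ-≤ (f i) (sum-nonneg (0≤f ∘ punchIn i)) ⟩
    f i + sum (removeAt f i) ≈⟨ sum-remove f ⟨
    sum f                    ∎

  open import Algebra.Properties.Semiring.Mult semiring using (×-homo-+; ×1-homo-*) renaming (_×_ to _×ᵣ_)

  fromℕ≡×1 : ∀ k → fromℕ k ≡ k ×ᵣ 1#
  fromℕ≡×1 ℕ.zero    = ≡.refl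
  fromℕ≡×1 (ℕ.suc k) = ≡.cong (1# +_) (fromℕ≡×1 k)

  fromℕ-+ : ∀ j k → fromℕ (j ℕ.+ k) ≈ fromℕ j + fromℕ k
  fromℕ-+ j k rewrite fromℕ≡×1 j | fromℕ≡×1 k | fromℕ≡×1 (j ℕ.+ k) = ×-homo-+ 1# j k

  fromℕ-* : ∀ j k → fromℕ (j ℕ.* k) ≈ fromℕ j * fromℕ k
  fromℕ-* j k rewrite fromℕ≡×1 j | fromℕ≡×1 k | fromℕ≡×1 (j ℕ.* k) = ×1-homo-* j k

  fromℕ-sum : ∀ {k} (f : Fin k → ℕ) → fromℕ (ℕΣ.sum f) ≈ sum (fromℕ ∘ f)
  fromℕ-sum {ℕ.zero}  f = refl
  fromℕ-sum {ℕ.suc k} f = trans (fromℕ-+ (f zero) (ℕΣ.sum (f ∘ suc))) (+-congˡ (fromℕ-sum (f ∘ suc)))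

  fromℕ-nonneg : ∀ k → 0# ≤ fromℕ k
  fromℕ-nonneg ℕ.zero    = ≤-refl
  fromℕ-nonneg (ℕ.suc k) = ≤-trans (≤-reflexive (sym (+-identityˡ 0#))) (+-mono-≤ 0≤1 (fromℕ-nonneg k))

  fromℕ-mono-≤ : ∀ {j k} → j ≤ℕ k → fromℕ j ≤ fromℕ k
  fromℕ-mono-≤ {j} j≤k with ℕₚ.m≤n⇒∃[o]m+o≡n j≤k
  ... | i , ≡.refl = begin
    fromℕ j            ≈⟨ +-identityʳ (fromℕ j) ⟨
    fromℕ j + 0#       ≤⟨ +-monoʳ-≤ (fromℕ j) (fromℕ-nonneg i) ⟩
    fromℕ j + fromℕ i  ≈⟨ fromℕ-+ j i ⟨
    fromℕ (j ℕ.+ i)    ∎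

  sign : Carrier → Carrier
  sign x with total 0# x
  ... | inj₁ _ = 1#
  ... | inj₂ _ = - 1#

  abs : Carrier → Carrier
  abs x = sign x * x

  0≤abs : ∀ x → 0# ≤ abs x
  0≤abs x with total 0# x
  ... | inj₁ 0≤x = ≤-trans 0≤x (≤-reflexive (sym (*-identityˡ x)))
  ... | inj₂ x≤0 = ≤-trans (x≤0⇒0≤-x x≤0) (≤-reflexive (sym (-1*x≈-x x)))

  sign*≤abs : ∀ x y → sign x * y ≤ abs y
  sign*≤abs x y with total 0# x | total 0# y
  ... | inj₁ _ | inj₁ _   = ≤-refl
  ... | inj₂ _ | inj₂ _   = ≤-refl
  ... | inj₁ _ | inj₂ y≤0 = begin
    1# * y   ≈⟨ *-identityˡ y ⟩
    y        ≤⟨ y≤0 ⟩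
    0#       ≤⟨ x≤0⇒0≤-x y≤0 ⟩
    - y      ≈⟨ -1*x≈-x y ⟨
    - 1# * y ∎
  ... | inj₂ _ | inj₁ 0≤y = begin
    - 1# * y ≈⟨ -1*x≈-x y ⟩
    - y      ≤⟨ 0≤x⇒-x≤0 0≤y ⟩
    0#       ≤⟨ 0≤y ⟩
    y        ≈⟨ *-identityˡ y ⟨
    1# * y   ∎

  abs≈0⇒x≈0 : ∀ {x} → abs x ≈ 0# → x ≈ 0#
  abs≈0⇒x≈0 {x} = x≉0∧xy≈0⇒y≈0 (sign≉0 x)
    where
    sign≉0 : ∀ x → ¬ (sign x ≈ 0#)
    sign≉0 x with total 0# x
    ... | inj₁ _ = 0≉1 ∘ sym
    ... | inj₂ _ = λ -1≈0 → 0≉1 (sym (trans (sym (-‿involutive 1#)) (trans (-‿cong -1≈0) -0#≈0#)))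

module Eigenvalues {c ℓ₁ ℓ₂} (F : OrderedField c ℓ₁ ℓ₂) where
  open OrderedField F
  open OrderedFieldProperties F
  open import Algebra.Properties.CommutativeSemigroup (CommutativeRing.*-commutativeSemigroup commutativeRing)
    using (x∙yz≈yx∙z)
  open import Algebra.Properties.CommutativeSemigroup (CommutativeRing.+-commutativeSemigroup commutativeRing)
    using (xy∙z≈y∙xz)
  open import Data.List.Extrema totalOrder using (argmax; f[⊥]≤f[argmax]; f[xs]≤f[argmax])

  Matrix : ℕ → ℕ → Set c
  Matrix k l = Fin k → Fin l → Carrier

  transpose : ∀ {k l} → Matrix k l → Matrix l k
  transpose = flip

  infix 7 _·_
  _·_ : ∀ {k} → Vector Carrier k → Vector Carrier k → Carrier
  u · w = sum (λ i → u i * w i)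

  infixr 8 _*ᵥ_
  _*ᵥ_ : ∀ {k l} → Matrix k l → Vector Carrier l → Vector Carrier k
  (M *ᵥ v) i = M i · v

  ·-comm : ∀ {k} (u w : Vector Carrier k) → u · w ≈ w · u
  ·-comm u w = sum-cong-≋ (λ i → *-comm (u i) (w i))

  ·-*ᵥ-transpose : ∀ {k l} (u : Vector Carrier k) (M : Matrix k l) v → u · M *ᵥ v ≈ transpose M *ᵥ u · v
  ·-*ᵥ-transpose u M v = begin-equality
    sum (λ i → u i * sum (λ j → M i j * v j))     ≈⟨ sum-cong-≋ (λ i → *-distribˡ-sum (u i) (λ j → M i j * v j)) ⟩
    sum (λ i → sum (λ j → u i * (M i j * v j)))   ≈⟨ ∑-comm (λ i j → u i * (M i j * v j)) ⟩
    sum (λ j → sum (λ i → u i * (M i j * v j)))   ≈⟨ sum-cong-≋ (λ j → sum-cong-≋ (λ i → x∙yz≈yx∙z (u i) (M i j) (v j))) ⟩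
    sum (λ j → sum (λ i → M i j * u i * v j))     ≈⟨ sum-cong-≋ (λ j → *-distribʳ-sum (v j) (λ i → M i j * u i)) ⟨
    sum (λ j → sum (λ i → M i j * u i) * v j)     ∎

  ·-*ˡ : ∀ {k} (u : Vector Carrier k) μ w → u · (λ i → μ * w i) ≈ μ * (u · w)
  ·-*ˡ u μ w = begin-equality
    sum (λ i → u i * (μ * w i)) ≈⟨ sum-cong-≋ (λ i → x∙yz≈yx∙z (u i) μ (w i)) ⟩
    sum (λ i → μ * u i * w i)   ≈⟨ sum-cong-≋ (λ i → *-assoc μ (u i) (w i)) ⟩
    sum (λ i → μ * (u i * w i)) ≈⟨ *-distribˡ-sum μ (λ i → u i * w i) ⟨
    μ * (u · w)                 ∎

  ·-self-nonneg : ∀ {k} (u : Vector Carrier k) → 0# ≤ u · u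
  ·-self-nonneg u = sum-nonneg (λ i → x*x-nonneg (u i))

  ·-self≉0 : ∀ {k} (u : Vector Carrier k) {i} → ¬ (u i ≈ 0#) → ¬ (u · u ≈ 0#)
  ·-self≉0 u {i} uᵢ≉0 u·u≈0 = uᵢ≉0 (x≉0∧xy≈0⇒y≈0 uᵢ≉0 (antisym
    (≤-trans (≤-sum (λ j → x*x-nonneg (u j)) i) (≤-reflexive u·u≈0))
    (x*x-nonneg (u i))))

  eigenequation : ∀ {m} {M : Matrix m m} {μ v} → (∀ a → ∑ (λ b → M a b * v b) ≈ μ * v a) →
                  ∀ a → (M *ᵥ v) a ≈ μ * v a
  eigenequation {M = M} {v = v} eq a = trans (≈-reflexive (≡.sym (∑≡sum (λ b → M a b * v b)))) (eq a)

  gram-*ᵥ : ∀ {m n} {G : Matrix m m} (E : Matrix n m) →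
            (∀ a b → G a b ≈ transpose E a · transpose E b) →
            ∀ v a → (G *ᵥ v) a ≈ (transpose E *ᵥ E *ᵥ v) a
  gram-*ᵥ {G = G} E gram v a = begin-equality
    G a · v                            ≈⟨ sum-cong-≋ (λ b → *-congʳ (trans (gram a b) (·-comm (transpose E a) (transpose E b)))) ⟩
    (transpose E *ᵥ transpose E a) · v ≈⟨ ·-*ᵥ-transpose (transpose E a) E v ⟨
    transpose E a · E *ᵥ v             ∎

  gram⇒eigenvalue-nonneg : ∀ {m n} {G : Matrix m m} (E : Matrix n m) →
                           (∀ a b → G a b ≈ transpose E a · transpose E b) →
                           ∀ {μ} → IsEigenvalue F G μ → 0# ≤ μ
  gram⇒eigenvalue-nonneg {G = G} E gram {μ} (v , (a , vₐ≉0) , eigen) =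
    *-cancelʳ-≤ (·-self-nonneg v) (·-self≉0 v vₐ≉0) (begin
      0# * (v · v)               ≈⟨ zeroˡ (v · v) ⟩
      0#                         ≤⟨ ·-self-nonneg (E *ᵥ v) ⟩
      E *ᵥ v · E *ᵥ v            ≈⟨ ·-*ᵥ-transpose v (transpose E) (E *ᵥ v) ⟨
      v · transpose E *ᵥ E *ᵥ v  ≈⟨ sum-cong-≋ (λ b → *-congˡ (gram-*ᵥ E gram v b)) ⟨
      v · G *ᵥ v                 ≈⟨ sum-cong-≋ (λ b → *-congˡ (eigenequation eigen b)) ⟩
      v · (λ b → μ * v b)        ≈⟨ ·-*ˡ v μ v ⟩
      μ * (v · v)                ∎)

  *ᵥ-shift : ∀ {m} {A B : Matrix m m} c →
             (∀ a → B a a ≈ A a a + c) → (∀ {a b} → a ≢ b → B a b ≈ A a b) →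
             ∀ v a → (B *ᵥ v) a ≈ (A *ᵥ v) a + c * v a
  *ᵥ-shift {ℕ.suc m} {A} {B} c diagonal off-diagonal v a = begin-equality
    sum (Bv a)                                        ≈⟨ sum-remove (Bv a) ⟩
    B a a * v a + sum (removeAt (Bv a) a)             ≈⟨ +-cong (*-congʳ (diagonal a)) (sum-cong-≋ off-diagonal-terms) ⟩
    (A a a + c) * v a + sum (removeAt (Av a) a)       ≈⟨ +-congʳ (distribʳ (v a) (A a a) c) ⟩
    A a a * v a + c * v a + sum (removeAt (Av a) a)   ≈⟨ xy∙z≈y∙xz (A a a * v a) (c * v a) _ ⟩
    c * v a + (A a a * v a + sum (removeAt (Av a) a)) ≈⟨ +-congˡ (sum-remove (Av a)) ⟨
    c * v a + sum (Av a)                              ≈⟨ +-comm (c * v a) (sum (Av a)) ⟩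
    sum (Av a) + c * v a                              ∎
    where
    Av Bv : Fin (ℕ.suc m) → Vector Carrier (ℕ.suc m)
    Av i b = A i b * v b
    Bv i b = B i b * v b
    off-diagonal-terms : ∀ j → removeAt (Bv a) a j ≈ removeAt (Av a) a j
    off-diagonal-terms j = *-congʳ (off-diagonal (punchInᵢ≢i a j ∘ ≡.sym))

  eigenvalue-shift : ∀ {m} {A B : Matrix m m} {λ′} c →
                     (∀ a → B a a ≈ A a a + c) → (∀ {a b} → a ≢ b → B a b ≈ A a b) →
                     IsEigenvalue F A λ′ → IsEigenvalue F B (λ′ + c)
  eigenvalue-shift {A = A} {B} {λ′} c diagonal off-diagonal (v , nonzero , eigen) =
    v , nonzero , λ a → begin-equality
      ∑ (λ b → B a b * v b) ≡⟨ ∑≡sum (λ b → B a b * v b) ⟩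
      (B *ᵥ v) a            ≈⟨ *ᵥ-shift c diagonal off-diagonal v a ⟩
      (A *ᵥ v) a + c * v a  ≈⟨ +-congʳ (eigenequation eigen a) ⟩
      λ′ * v a + c * v a    ≈⟨ distribʳ (v a) λ′ c ⟨
      (λ′ + c) * v a        ∎

  -- Read the eigenequation at an entry of v of maximal absolute value.
  eigenvalue-≤-rowSum : ∀ {m} {M : Matrix m m} {k B μ} → (∀ a b → 0# ≤ M a b) → 0# ≤ k →
                        (∀ a → k * sum (M a) ≤ B) → IsEigenvalue F M μ → k * μ ≤ B
  eigenvalue-≤-rowSum {m} {M} {k} {B} {μ} 0≤M 0≤k k*rowSum≤B (v , (a₀ , vₐ₀≉0) , eigen) =
    *-cancelʳ-≤ 0≤p p≉0 (begin
      k * μ * p           ≈⟨ *-assoc k μ p ⟩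
      k * (μ * p)         ≤⟨ *-monoˡ-≤ 0≤k μp≤rowSum*p ⟩
      k * (sum (M a) * p) ≈⟨ *-assoc k (sum (M a)) p ⟨
      k * sum (M a) * p   ≤⟨ *-monoʳ-≤ 0≤p (k*rowSum≤B a) ⟩
      B * p               ∎)
    where
    a : Fin m
    a = argmax (abs ∘ v) a₀ (List.allFin m)
    p : Carrier
    p = abs (v a)
    0≤p : 0# ≤ p
    0≤p = 0≤abs (v a)
    ∣vₐ₀∣≤p : abs (v a₀) ≤ p
    ∣vₐ₀∣≤p = f[⊥]≤f[argmax] {f = abs ∘ v} a₀ (List.allFin m)
    ∣v∣≤p : ∀ b → abs (v b) ≤ p
    ∣v∣≤p b = All.lookup (f[xs]≤f[argmax] {f = abs ∘ v} a₀ (List.allFin m)) (∈-allFin b)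
    p≉0 : ¬ (p ≈ 0#)
    p≉0 p≈0 = vₐ₀≉0 (abs≈0⇒x≈0 (antisym (≤-trans ∣vₐ₀∣≤p (≤-reflexive p≈0)) (0≤abs (v a₀))))
    μp≤rowSum*p : μ * p ≤ sum (M a) * p
    μp≤rowSum*p = begin
      μ * (sign (v a) * v a)                 ≈⟨ x∙yz≈yx∙z μ (sign (v a)) (v a) ⟩
      sign (v a) * μ * v a                   ≈⟨ *-assoc (sign (v a)) μ (v a) ⟩
      sign (v a) * (μ * v a)                 ≈⟨ *-congˡ (eigenequation eigen a) ⟨
      sign (v a) * (M *ᵥ v) a                ≈⟨ *-distribˡ-sum (sign (v a)) (λ b → M a b * v b) ⟩
      sum (λ b → sign (v a) * (M a b * v b)) ≈⟨ sum-cong-≋ (λ b → x∙yz≈yx∙z (sign (v a)) (M a b) (v b)) ⟩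
      sum (λ b → M a b * sign (v a) * v b)   ≈⟨ sum-cong-≋ (λ b → *-assoc (M a b) (sign (v a)) (v b)) ⟩
      sum (λ b → M a b * (sign (v a) * v b)) ≤⟨ sum-mono-≤ (λ b → *-monoˡ-≤ (0≤M a b) (≤-trans (sign*≤abs (v a) (v b)) (∣v∣≤p b))) ⟩
      sum (λ b → M a b * p)                  ≈⟨ *-distribʳ-sum p (M a) ⟨
      sum (M a) * p                          ∎

module CliqueAdjacency {c ℓ₁ ℓ₂} (F : OrderedField c ℓ₁ ℓ₂) where
  open OrderedField F
  open OrderedFieldProperties F
  open Counting using (Nonempty⇒1≤∣p∣; Empty⇒∣p∣≡0)

  cliqueAdj-self : ∀ {n} (p : Subset n) → cliqueAdj F p p ≈ 0#
  cliqueAdj-self p with ≡-dec _≟ᵇ_ p p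
  ... | yes _   = refl
  ... | no  p≢p = contradiction ≡.refl p≢p

  cliqueAdj≈∣∩∣ : ∀ {n} {p q : Subset n} → p ≢ q → ∣ p ∩ q ∣ ≤ℕ 1 → cliqueAdj F p q ≈ fromℕ ∣ p ∩ q ∣
  cliqueAdj≈∣∩∣ {p = p} {q} p≢q ∣p∩q∣≤1 with ≡-dec _≟ᵇ_ p q
  ... | yes p≡q = contradiction p≡q p≢q
  ... | no  _ with nonempty? (p ∩ q)
  ...   | yes meet  rewrite ℕₚ.≤-antisym ∣p∩q∣≤1 (Nonempty⇒1≤∣p∣ meet) = sym (+-identityʳ 1#)
  ...   | no  empty rewrite Empty⇒∣p∣≡0 empty = refl

module CliqueGraphSpectrum {c ℓ₁ ℓ₂} (F : OrderedField c ℓ₁ ℓ₂) {n} (Γ : Graph n) (ω : ℕ)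
  (regular : CliqueRegular Γ ω) (Ks : List (Subset n)) (enumerates : EnumeratesCliques Γ ω Ks) where
  open OrderedField F
  open OrderedFieldProperties F
  open Eigenvalues F
  open CliqueAdjacency F
  open Counting using (𝟙; ∣p∩q∣≡∑𝟙*𝟙)

  m : ℕ
  m = List.length Ks

  K : Fin m → Subset n
  K = List.lookup Ks

  K-clique : ∀ a → IsClique Γ ω (K a)
  K-clique a = Equivalence.to (proj₂ enumerates (K a)) (∈-lookup a)

  K-injective : ∀ {a b} → K a ≡ K b → a ≡ b
  K-injective = lookup-injective (proj₁ enumerates)

  K-edge-unique : ∀ {a b x y} → x ≢ y → x ∈ K a → y ∈ K a → x ∈ K b → y ∈ K b → a ≡ b
  K-edge-unique {a} {b} x≢y x∈a y∈a x∈b y∈b =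
    let _ , _ , _ , _ , unique = proj₂ regular _ _ (proj₂ (K-clique a) _ _ x∈a y∈a x≢y)
    in K-injective (≡.trans (unique (K a) (K-clique a) x∈a y∈a) (≡.sym (unique (K b) (K-clique b) x∈b y∈b)))

  open EdgeDisjointCliques Γ ω K K-clique K-edge-unique

  intersections : Matrix m m
  intersections a b = fromℕ ∣ K a ∩ K b ∣

  incidence : Matrix n m
  incidence x a = fromℕ (𝟙 (K a) x)

  intersections-gram : ∀ a b → intersections a b ≈ transpose incidence a · transpose incidence b
  intersections-gram a b = begin-equality
    fromℕ ∣ K a ∩ K b ∣                            ≡⟨ ≡.cong fromℕ (∣p∩q∣≡∑𝟙*𝟙 (K a) (K b)) ⟩
    fromℕ (ℕΣ.sum (λ x → 𝟙 (K a) x ℕ.* 𝟙 (K b) x)) ≈⟨ fromℕ-sum (λ x → 𝟙 (K a) x ℕ.* 𝟙 (K b) x) ⟩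
    sum (λ x → fromℕ (𝟙 (K a) x ℕ.* 𝟙 (K b) x))    ≈⟨ sum-cong-≋ (λ x → fromℕ-* (𝟙 (K a) x) (𝟙 (K b) x)) ⟩
    transpose incidence a · transpose incidence b  ∎

  intersections-eigenvalue : ∀ {λ′} → IsEigenvalue F (cliqueGraphMatrix F Ks) λ′ →
                             IsEigenvalue F intersections (λ′ + fromℕ ω)
  intersections-eigenvalue = eigenvalue-shift (fromℕ ω) diagonal off-diagonal
    where
    diagonal : ∀ a → intersections a a ≈ cliqueAdj F (K a) (K a) + fromℕ ω
    diagonal a = begin-equality
      fromℕ ∣ K a ∩ K a ∣                ≡⟨ ≡.cong fromℕ (∣K∩K∣≡ω a) ⟩
      fromℕ ω                            ≈⟨ +-identityˡ (fromℕ ω) ⟨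
      0# + fromℕ ω                       ≈⟨ +-congʳ (cliqueAdj-self (K a)) ⟨
      cliqueAdj F (K a) (K a) + fromℕ ω  ∎
    off-diagonal : ∀ {a b} → a ≢ b → intersections a b ≈ cliqueAdj F (K a) (K b)
    off-diagonal a≢b = sym (cliqueAdj≈∣∩∣ (a≢b ∘ K-injective) (∣K∩K∣≤1 a≢b))

  intersections-nonneg : ∀ a b → 0# ≤ intersections a b
  intersections-nonneg a b = fromℕ-nonneg ∣ K a ∩ K b ∣

  intersections-rowSum : ∀ a → fromℕ (ω ∸ 1) * sum (intersections a) ≤ fromℕ ω * fromℕ (maxDegree Γ)
  intersections-rowSum a = begin
    fromℕ (ω ∸ 1) * sum (intersections a)                ≈⟨ *-congˡ (fromℕ-sum (λ b → ∣ K a ∩ K b ∣)) ⟨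
    fromℕ (ω ∸ 1) * fromℕ (ℕΣ.sum (λ b → ∣ K a ∩ K b ∣)) ≈⟨ fromℕ-* (ω ∸ 1) _ ⟨
    fromℕ ((ω ∸ 1) ℕ.* ℕΣ.sum (λ b → ∣ K a ∩ K b ∣))     ≤⟨ fromℕ-mono-≤ (∸1*∑∣K∩K∣≤ω*maxDegree a) ⟩
    fromℕ (ω ℕ.* maxDegree Γ)                            ≈⟨ fromℕ-* ω (maxDegree Γ) ⟩
    fromℕ ω * fromℕ (maxDegree Γ)                        ∎

corollary3p3 : ∀ {c ℓ₁ ℓ₂ : Level} (F : OrderedField c ℓ₁ ℓ₂) {n : ℕ} (Γ : Graph n) (ω : ℕ) →
    2 ≤ℕ ω → CliqueRegular Γ ω →
    (Ks : List (Subset n)) → EnumeratesCliques Γ ω Ks →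
    ∀ λ′ → IsEigenvalue F (cliqueGraphMatrix F Ks) λ′ →
      let open OrderedField F in
      (- fromℕ ω ≤ λ′) ×
      (fromℕ (ω ∸ 1) * λ′ ≤ fromℕ ω * fromℕ (maxDegree Γ) - fromℕ (ω *ℕ (ω ∸ 1)))
corollary3p3 F Γ ω _ regular Ks enumerates λ′ isEigenvalue = -ω≤λ′ , upper
  where
  open OrderedField F
  open OrderedFieldProperties F
  open Eigenvalues F
  open CliqueGraphSpectrum F Γ ω regular Ks enumerates

  ω′ k : Carrier
  ω′ = fromℕ ω
  k  = fromℕ (ω ∸ 1)

  shifted : IsEigenvalue F intersections (λ′ + ω′)
  shifted = intersections-eigenvalue isEigenvalue

  -ω≤λ′ : - ω′ ≤ λ′
  -ω≤λ′ = +-cancelʳ-≤ ω′ (begin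
    - ω′ + ω′  ≈⟨ -‿inverseˡ ω′ ⟩
    0#         ≤⟨ gram⇒eigenvalue-nonneg incidence intersections-gram shifted ⟩
    λ′ + ω′    ∎)

  upper : k * λ′ ≤ ω′ * fromℕ (maxDegree Γ) - fromℕ (ω *ℕ (ω ∸ 1))
  upper = x+z≤y⇒x≤y-z (begin
    k * λ′ + fromℕ (ω *ℕ (ω ∸ 1))  ≈⟨ +-congˡ (trans (fromℕ-* ω (ω ∸ 1)) (*-comm ω′ k)) ⟩
    k * λ′ + k * ω′                ≈⟨ distribˡ k λ′ ω′ ⟨
    k * (λ′ + ω′)                  ≤⟨ eigenvalue-≤-rowSum intersections-nonneg (fromℕ-nonneg (ω ∸ 1)) intersections-rowSum shifted ⟩
    ω′ * fromℕ (maxDegree Γ)       ∎)
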